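{- Let $\Gamma$ be a temporal theory and let $M=\langle(W,\preccurlyeq,S),V\rangle$ be a total $\mathrm{THT}$ model. Let $T:=\{\circ^ip\mid p\in V((i,0)),\ i\ge0\}\subseteq\mathbb{P}^{\circ}$. Then $M$ is a temporal equilibrium model of $\Gamma$ if and only if $T$ is a $\mathrm{THT}$-temporal safe belief set of $\Gamma$.
   Context: Temporal formulas over a countable set $\mathbb{P}$ of atoms are generated by $\varphi ::= p \mid \bot \mid \varphi\wedge\varphi \mid \varphi\vee\varphi \mid \varphi\to\varphi \mid \circ\varphi \mid \varphi\,\mathcal{U}\,\varphi \mid \varphi\,\mathcal{R}\,\varphi$, with $\neg\varphi:=\varphi\to\bot$, $\circ^0\varphi:=\varphi$, and $\circ^{i+1}\varphi:=\circ\circ^i\varphi$. Let $\mathbb{P}^{\circ}:=\{\circ^ip\mid p\in\mathbb{P},i\ge0\}$. A $\mathrm{THT}$ model is $\langle(W,\preccurlyeq,S),V\rangle$ where $W=\mathbb{N}\times\{0,1\}$, $(i,h)\preccurlyeq(j,t)$ iff $i=j$ and $h\le t$, $S((i,k))=(i+1,k)$, and $V:W\to2^{\mathbb{P}}$ satisfies $V((i,0))\subseteq V((i,1))$. Satisfaction is defined as follows: - $p$ holds at $w$ iff $p\in V(w)$. - $\bot$ never holds. - $\wedge$ and $\vee$ are pointwise. - $\varphi\to\psi$ holds at $w$ iff for all $v\succcurlyeq w$, if $\varphi$ holds at $v$ then $\psi$ holds at $v$. - $\circ\varphi$ holds at $w$ iff $\varphi$ holds at $S(w)$. - $\varphi\,\mathcal{U}\,\psi$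 holds at $w$ iff for some $k\ge0$, $\psi$ holds at $S^k(w)$ and $\varphi$ holds at $S^i(w)$ for all $0\le i<k$. - $\varphi\,\mathcal{R}\,\psi$ holds at $w$ iff for all $k\ge0$, $\psi$ holds at $S^k(w)$ or $\varphi$ holds at $S^i(w)$ for some $0\le i<k$. A set of formulas holds at a world if each of its members does. - $\Sigma$ is $\mathrm{THT}$-consistent if some $\mathrm{THT}$ model and world satisfy $\Sigma$. - $\Sigma\models_{\mathrm{THT}}\Delta$ if every $\mathrm{THT}$ model and world satisfying $\Sigma$ satisfies every formula of $\Delta$. A set $T\subseteq\mathbb{P}^{\circ}$ is a $\mathrm{THT}$-temporal safe belief set of $\Gamma$ if, letting $\Sigma:=\Gamma\cup\{\circ^i\neg\neg p\mid\circ^ip\in T\}\cup\{\circ^i\neg p\mid\circ^ip\in\mathbb{P}^{\circ}\setminus T\}$, $\Sigma$ is $\mathrm{THT}$-consistent and $\Sigma\models_{\mathrm{THT}}T$. $M$ is total if $V((i,0))=V((i,1))$ for all $i$. For $\mathrm{THT}$ models on the same frame: - $M'\le M$ if $V'((i,1))=V((i,1))$ and $V'((i,0))\subseteq V((i,0))$ for all $i$. - $M'<M$ if $M'\le M$ and $V'\ne V$. A total $\mathrm{THT}$ model $M$ is a temporal equilibrium model of $\Gamma$ if $M,(0,0)\models\Gamma$ and there is no $M'<M$ with $M',(0,0)\models\Gamma$. -}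

module Defs where

open import Level using (Level) renaming (zero to lzero; suc to lsuc)
open import Data.Nat using (ℕ; zero; suc; _+_; _<_)
open import Data.Bool using (Bool; true; false)
open import Data.Product using (Σ; Σ-syntax; ∃; ∃-syntax; _×_; _,_)
open import Data.Sum using (_⊎_)
open import Data.Empty using (⊥)
open import Relation.Nullary using (¬_)
open import Relation.Binary.PropositionalEquality using (_≡_)
open import Function.Definitions using (Injective)

Countable : Set → Set
Countable A = Σ (A → ℕ) (λ enc → Injective _≡_ _≡_ enc)

data Formula (A : Set) : Set where
  atom : A → Formula A
  ⊥f   : Formula A
  _∧f_ : Formula A → Formula A → Formula A
  _∨f_ : Formula A → Formula A → Formula A
  _⇒f_ : Formula A → Formula A → Formula A
  ○_   : Formula A → Formula A
  _𝒰_  : Formula A → Formula A → Formula A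
  _ℛ_  : Formula A → Formula A → Formula A

module _ {A : Set} where

  ¬f_ : Formula A → Formula A
  ¬f φ = φ ⇒f ⊥f

  ○^ : ℕ → Formula A → Formula A
  ○^ zero    φ = φ
  ○^ (suc i) φ = ○ (○^ i φ)

-- Worlds W = ℕ × {0,1}; the second component is 'false' for 0 (here) and 'true' for 1 (there).
World : Set
World = ℕ × Bool

data _≤B_ : Bool → Bool → Set where
  f≤b : ∀ {b} → false ≤B b
  t≤t : true ≤B true

data _≼_ : World → World → Set where
  step≼ : ∀ {i h t} → h ≤B t → (i , h) ≼ (i , t)

S^ : ℕ → World → World
S^ k (i , h) = (k + i , h)

record Model (A : Set) : Set where
  field
    V    : ℕ → Bool → A → Bool
    mono : ∀ i p → V i false p ≡ true → V i true p ≡ true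
open Model public

module _ {A : Set} where

  Val : Model A → World → A → Set
  Val M (i , h) p = V M i h p ≡ true

  Sat : Model A → World → Formula A → Set
  Sat M w (atom p) = Val M w p
  Sat M w ⊥f       = ⊥
  Sat M w (φ ∧f ψ) = Sat M w φ × Sat M w ψ
  Sat M w (φ ∨f ψ) = Sat M w φ ⊎ Sat M w ψ
  Sat M w (φ ⇒f ψ) = ∀ v → w ≼ v → Sat M v φ → Sat M v ψ
  Sat M w (○ φ)    = Sat M (S^ 1 w) φ
  Sat M w (φ 𝒰 ψ)  = Σ[ k ∈ ℕ ] (Sat M (S^ k w) ψ × (∀ i → i < k → Sat M (S^ i w) φ))
  Sat M w (φ ℛ ψ)  = ∀ k → Sat M (S^ k w) ψ ⊎ (Σ[ i ∈ ℕ ] (i < k × Sat M (S^ i w) φ))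

  SatSet : Model A → World → (Formula A → Set) → Set
  SatSet M w Σ' = ∀ φ → Σ' φ → Sat M w φ

  THT-consistent : (Formula A → Set) → Set
  THT-consistent Σ' = Σ[ M ∈ Model A ] Σ[ w ∈ World ] SatSet M w Σ'

  _⊨THT_ : (Formula A → Set) → (Formula A → Set) → Set
  Σ' ⊨THT Δ = ∀ (M : Model A) (w : World) → SatSet M w Σ' → SatSet M w Δ

  -- Subsets of ℙ° = {○^i p}, represented by pairs (i , p) standing for ○^i p.
  SubsetP° : Set₁
  SubsetP° = ℕ → A → Set

  asFormulas : SubsetP° → Formula A → Set
  asFormulas T φ = ∃[ i ] ∃[ p ] (T i p × φ ≡ ○^ i (atom p))

  SigmaOf : (Formula A → Set) → SubsetP° → Formula A → Set
  SigmaOf Γ T φ =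
    Γ φ
    ⊎ (∃[ i ] ∃[ p ] (T i p × φ ≡ ○^ i (¬f (¬f (atom p)))))
    ⊎ (∃[ i ] ∃[ p ] (¬ T i p × φ ≡ ○^ i (¬f (atom p))))

  TemporalSafeBeliefSet : (Formula A → Set) → SubsetP° → Set
  TemporalSafeBeliefSet Γ T =
    THT-consistent (SigmaOf Γ T) × (SigmaOf Γ T ⊨THT asFormulas T)

  Total : Model A → Set
  Total M = ∀ i p → V M i false p ≡ V M i true p

  _≤M_ : Model A → Model A → Set
  M' ≤M M = (∀ i p → V M' i true p ≡ V M i true p)
          × (∀ i p → V M' i false p ≡ true → V M i false p ≡ true)

  _<M_ : Model A → Model A → Set
  M' <M M = M' ≤M M × ¬ (∀ i h p → V M' i h p ≡ V M i h p)

  TemporalEquilibriumModel : (Formula A → Set) → Model A → Set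
  TemporalEquilibriumModel Γ M =
    Total M × SatSet M (0 , false) Γ
    × ¬ (Σ[ M' ∈ Model A ] (M' <M M × SatSet M' (0 , false) Γ))

  TOf : Model A → SubsetP°
  TOf M i p = V M i false p ≡ true

-- The formulas ○^i ¬¬p and ○^i ¬p only see there-worlds, so every model of
-- Σ = Γ ∪ {○^i ¬¬p | p ∈ T} ∪ {○^i ¬p | p ∉ T} has exactly the there-part of the
-- total model M, and hence a here-part contained in that of M. THT satisfaction is
-- invariant under passing to the submodel generated by a world, so every model of Σ
-- may be taken at (0 , here), where it is just a Γ-model N ≤ M. Thus Σ ⊨ T says
-- that every Γ-model N ≤ M also has the here-part of M, i.e. equals M: this is the
-- minimality of M.
module Submission where

open import Defs
open import Data.Bool using (Bool; true; false; _∨_)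
open import Data.Bool.Properties using (¬-not; not-¬; ⇔→≡; ∨-identityʳ)
open import Data.Nat using (ℕ; zero; suc; _+_)
open import Data.Nat.Properties using (+-assoc; +-suc; +-identityʳ)
open import Data.Product using (Σ-syntax; ∃-syntax; _×_; _,_; proj₁)
open import Data.Product.Function.Dependent.Propositional using (Σ-⇔)
open import Data.Product.Function.NonDependent.Propositional using (_×-⇔_)
open import Data.Sum using (inj₁; inj₂)
open import Data.Sum.Function.Propositional using (_⊎-⇔_)
open import Function using (_∘_; id)
open import Function.Bundles using (_⇔_; mk⇔; Equivalence)
open import Function.Construct.Identity using (⇔-id; ↠-id)
open import Function.Construct.Symmetry using (⇔-sym)
open import Function.Related.TypeIsomorphisms using (→-cong-⇔)
open import Relation.Binary.PropositionalEquality using (_≡_; refl; sym; trans; subst; cong)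
open import Relation.Nullary using (¬_)

open Equivalence using (to; from)

Π-⇔ : {P Q : ℕ → Set} → (∀ k → P k ⇔ Q k) → (∀ k → P k) ⇔ (∀ k → Q k)
Π-⇔ P⇔Q = mk⇔ (λ p k → to (P⇔Q k) (p k)) (λ q k → from (P⇔Q k) (q k))

≤B-true : ∀ b → b ≤B true
≤B-true false = f≤b
≤B-true true  = t≤t

∨-monoˡ-≤B : ∀ {h h′} b → h ≤B h′ → (h ∨ b) ≤B (h′ ∨ b)
∨-monoˡ-≤B                false f≤b = f≤b
∨-monoˡ-≤B {h′ = false} true  f≤b = t≤t
∨-monoˡ-≤B {h′ = true}  true  f≤b = t≤t
∨-monoˡ-≤B              b     t≤t = t≤t

∨-≤B-lift : ∀ h b {t} → (h ∨ b) ≤B t → ∃[ h′ ] (h ≤B h′ × h′ ∨ b ≡ t)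
∨-≤B-lift false false (f≤b {t}) = t , f≤b , ∨-identityʳ t
∨-≤B-lift false true  t≤t       = false , f≤b , refl
∨-≤B-lift true  b     t≤t       = true , t≤t , refl

origin : World
origin = 0 , false

module _ {A : Set} where

  private
    variable
      N M : Model A
      φ : Formula A
      Γ Δ : Formula A → Set
      T : SubsetP° {A}
      n : ℕ
      h : Bool

  SameValuation : Model A → Model A → Set
  SameValuation N M = ∀ i h p → V N i h p ≡ V M i h p

  SameThere : Model A → Model A → Set
  SameThere N M = ∀ i p → V N i true p ≡ V M i true p

  HereIncluded : Model A → Model A → Set
  HereIncluded M N = ∀ i p → V M i false p ≡ true → V N i false p ≡ true

  val-mono : ∀ (N : Model A) {i h h′ p} → h ≤B h′ → V N i h p ≡ true → V N i h′ p ≡ true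
  val-mono N             (f≤b {false}) = id
  val-mono N {i} {p = p} (f≤b {true})  = mono N i p
  val-mono N             t≤t           = id

  record BoundedMorphism (N M : Model A) (f : World → World) : Set where
    field
      val-⇔      : ∀ w p → Val N w p ⇔ Val M (f w) p
      commutes-S : ∀ k w → f (S^ k w) ≡ S^ k (f w)
      forth      : ∀ {w v} → w ≼ v → f w ≼ f v
      back       : ∀ {w u} → f w ≼ u → ∃[ v ] (w ≼ v × f v ≡ u)

  module _ {f : World → World} (bm : BoundedMorphism N M f) where
    open BoundedMorphism bm

    private
      along-S^ : ∀ φ → (∀ v → Sat N v φ ⇔ Sat M (f v) φ)
               → ∀ w k → Sat N (S^ k w) φ ⇔ Sat M (S^ k (f w)) φ
      along-S^ φ ih w k = subst (λ u → Sat N (S^ k w) φ ⇔ Sat M u φ) (commutes-S k w) (ih (S^ k w))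

    sat-invariant : ∀ φ w → Sat N w φ ⇔ Sat M (f w) φ
    sat-invariant (atom p) w = val-⇔ w p
    sat-invariant ⊥f       w = ⇔-id _
    sat-invariant (φ ∧f ψ) w = sat-invariant φ w ×-⇔ sat-invariant ψ w
    sat-invariant (φ ∨f ψ) w = sat-invariant φ w ⊎-⇔ sat-invariant ψ w
    sat-invariant (φ ⇒f ψ) w = mk⇔ forward backward
      where
      forward : Sat N w (φ ⇒f ψ) → Sat M (f w) (φ ⇒f ψ)
      forward s u fw≼u x with back fw≼u
      ... | v , w≼v , refl = to (sat-invariant ψ v) (s v w≼v (from (sat-invariant φ v) x))
      backward : Sat M (f w) (φ ⇒f ψ) → Sat N w (φ ⇒f ψ)
      backward s v w≼v x = from (sat-invariant ψ v) (s (f v) (forth w≼v) (to (sat-invariant φ v) x))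
    sat-invariant (○ φ)    w = along-S^ φ (sat-invariant φ) w 1
    sat-invariant (φ 𝒰 ψ)  w = Σ-⇔ (↠-id ℕ) λ {k} →
      along-S^ ψ (sat-invariant ψ) w k
        ×-⇔ Π-⇔ λ i → →-cong-⇔ (⇔-id _) (along-S^ φ (sat-invariant φ) w i)
    sat-invariant (φ ℛ ψ)  w = Π-⇔ λ k →
      along-S^ ψ (sat-invariant ψ) w k
        ⊎-⇔ Σ-⇔ (↠-id ℕ) λ {i} → ⇔-id _ ×-⇔ along-S^ φ (sat-invariant φ) w i

  embed : World → World → World
  embed (n , b) (i , h) = i + n , h ∨ b

  -- The worlds reachable from (n , b), reindexed so that (n , b) becomes (0 , false).
  generated : Model A → World → Model A
  generated N (n , b) = record
    { V    = λ i h → V N (i + n) (h ∨ b)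
    ; mono = λ i p → val-mono N (≤B-true b)
    }

  generated-morphism : ∀ {N′} w → SameValuation N′ (generated N w) → BoundedMorphism N′ N (embed w)
  generated-morphism (n , b) same = record
    { val-⇔      = λ { (i , h) p → mk⇔ (trans (sym (same i h p))) (trans (same i h p)) }
    ; commutes-S = λ { k (i , h) → cong (_, h ∨ b) (+-assoc k i n) }
    ; forth      = λ { (step≼ h≤h′) → step≼ (∨-monoˡ-≤B b h≤h′) }
    ; back       = λ { {i , h} (step≼ h∨b≤t) → let h′ , h≤h′ , h′∨b≡t = ∨-≤B-lift h b h∨b≤t
                                              in (i , h′) , step≼ h≤h′ , cong (i + n ,_) h′∨b≡t }
    }

  sat-generated : ∀ {N′} w → SameValuation N′ (generated N w) → ∀ φ → Sat N w φ ⇔ Sat N′ origin φ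
  sat-generated (n , b) same φ = ⇔-sym (sat-invariant (generated-morphism (n , b) same) φ origin)

  satSet-generated : ∀ w → SatSet N w Γ → SatSet (generated N w) origin Γ
  satSet-generated w sat φ γ = to (sat-generated w (λ _ _ _ → refl) φ) (sat φ γ)

  ⊨THT-from-origin : (∀ N → SatSet N origin Γ → SatSet N origin Δ) → Γ ⊨THT Δ
  ⊨THT-from-origin ent N w sat φ δ =
    from (sat-generated w (λ _ _ _ → refl) φ) (ent (generated N w) (satSet-generated w sat) φ δ)

  sat-○^ : ∀ i → Sat N (n , h) (○^ i φ) ⇔ Sat N (i + n , h) φ
  sat-○^ zero = ⇔-id _
  sat-○^ {N} {n} {h} {φ} (suc i) =
    subst (λ m → Sat N (suc n , h) (○^ i φ) ⇔ Sat N (m , h) φ) (+-suc i n) (sat-○^ i)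

  sat-○^-origin : ∀ N i φ → Sat N (0 , h) (○^ i φ) ⇔ Sat N (i , h) φ
  sat-○^-origin {h} N i φ =
    subst (λ m → Sat N (0 , h) (○^ i φ) ⇔ Sat N (m , h) φ) (+-identityʳ i) (sat-○^ i)

  sat-¬atom : ∀ N m p → Sat N (m , h) (¬f (atom p)) ⇔ V N m true p ≡ false
  sat-¬atom {h} N m p = mk⇔
    (λ ¬p → ¬-not (¬p (m , true) (step≼ (≤B-true h))))
    (λ { ≡false (_ , _) (step≼ _) p → not-¬ ≡false (val-mono N (≤B-true _) p) })

  sat-¬¬atom : ∀ N m p → Sat N (m , h) (¬f (¬f (atom p))) ⇔ V N m true p ≡ true
  sat-¬¬atom {h} N m p = mk⇔
    (λ ¬¬p → ¬-not (λ ≡false → ¬¬p (m , true) (step≼ (≤B-true h)) (from (sat-¬atom N m p) ≡false)))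
    (λ { ≡true (_ , _) (step≼ _) ¬p → not-¬ ≡true (to (sat-¬atom N m p) ¬p) })

  sat-asFormulas-origin : ∀ N → SatSet N origin (asFormulas T) ⇔ (∀ i p → T i p → Val N (i , false) p)
  sat-asFormulas-origin N = mk⇔
    (λ sat i p t → to (sat-○^-origin N i (atom p)) (sat _ (i , p , t , refl)))
    (λ { T⊆N _ (i , p , t , refl) → from (sat-○^-origin N i (atom p)) (T⊆N i p t) })

  ≤M-antisym : ∀ N M → N ≤M M → HereIncluded M N → SameValuation N M
  ≤M-antisym N M (same , _)     _    i true  p = same i p
  ≤M-antisym N M (_ , N⊆M) M⊆N i false p = ⇔→≡ (mk⇔ (N⊆M i p) (M⊆N i p))

  equilibrium-minimal : ∀ N → TemporalEquilibriumModel Γ M → N ≤M M → SatSet N origin Γ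
                      → HereIncluded M N
  equilibrium-minimal N (_ , _ , minimal) N≤M satΓ i p here =
    ¬-not λ ≡false → minimal (N , (N≤M , λ same → not-¬ ≡false (trans (same i false p) here)) , satΓ)

  module _ {M : Model A} (total : Total M) where

    SameThere⇒≤M : ∀ N → SameThere N M → N ≤M M
    SameThere⇒≤M N same = same , λ i p here → trans (total i p) (trans (sym (same i p)) (mono N i p here))

    sat-SigmaOf⇒SameThere : ∀ N → SatSet N origin (SigmaOf Γ (TOf M)) → SameThere N M
    sat-SigmaOf⇒SameThere N sat i p with V M i true p in eq
    ... | true  = to (sat-¬¬atom N i p) (to (sat-○^-origin N i _)
                    (sat _ (inj₂ (inj₁ (i , p , trans (total i p) eq , refl)))))
    ... | false = to (sat-¬atom N i p) (to (sat-○^-origin N i _)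
                    (sat _ (inj₂ (inj₂ (i , p , not-¬ eq ∘ trans (sym (total i p)) , refl)))))

    SameThere⇒sat-SigmaOf : ∀ N → SameThere N M → SatSet N origin Γ
                          → SatSet N origin (SigmaOf Γ (TOf M))
    SameThere⇒sat-SigmaOf N same satΓ φ (inj₁ γ) = satΓ φ γ
    SameThere⇒sat-SigmaOf N same satΓ _ (inj₂ (inj₁ (i , p , here , refl))) =
      from (sat-○^-origin N i _)
        (from (sat-¬¬atom N i p) (trans (same i p) (trans (sym (total i p)) here)))
    SameThere⇒sat-SigmaOf N same satΓ _ (inj₂ (inj₂ (i , p , ¬here , refl))) =
      from (sat-○^-origin N i _)
        (from (sat-¬atom N i p) (trans (same i p) (¬-not (¬here ∘ trans (total i p)))))

    safe-belief-model⇒SameValuation : SigmaOf Γ (TOf M) ⊨THT asFormulas (TOf M)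
      → ∀ N → SatSet N origin (SigmaOf Γ (TOf M)) → SameValuation N M
    safe-belief-model⇒SameValuation ent N sat =
      ≤M-antisym N M (SameThere⇒≤M N (sat-SigmaOf⇒SameThere N sat))
                     (to (sat-asFormulas-origin N) (ent N origin sat))

    equilibrium⇒safe-belief : TemporalEquilibriumModel Γ M → TemporalSafeBeliefSet Γ (TOf M)
    equilibrium⇒safe-belief tem@(_ , satΓ , _) =
      (M , origin , SameThere⇒sat-SigmaOf M (λ _ _ → refl) satΓ) ,
      ⊨THT-from-origin λ N sat → from (sat-asFormulas-origin N)
        (equilibrium-minimal N tem (SameThere⇒≤M N (sat-SigmaOf⇒SameThere N sat))
                                   (λ φ γ → sat φ (inj₁ γ)))

    safe-belief⇒equilibrium : TemporalSafeBeliefSet Γ (TOf M) → TemporalEquilibriumModel Γ M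
    safe-belief⇒equilibrium {Γ} ((N , w , sat) , ent) = total , satΓ , minimal
      where
      N≗M : SameValuation (generated N w) M
      N≗M = safe-belief-model⇒SameValuation ent (generated N w) (satSet-generated w sat)

      satΓ : SatSet M origin Γ
      satΓ φ γ = to (sat-generated w (λ i h p → sym (N≗M i h p)) φ) (sat φ (inj₁ γ))

      minimal : ¬ (Σ[ M′ ∈ Model A ] (M′ <M M × SatSet M′ origin Γ))
      minimal (M′ , (M′≤M , M′≢M) , satΓ′) =
        M′≢M (safe-belief-model⇒SameValuation ent M′ (SameThere⇒sat-SigmaOf M′ (proj₁ M′≤M) satΓ′))

proposition12 : {A : Set} → Countable A → (Γ : Formula A → Set) → (M : Model A) → Total M
    → (TemporalEquilibriumModel Γ M → TemporalSafeBeliefSet Γ (TOf M))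
      × (TemporalSafeBeliefSet Γ (TOf M) → TemporalEquilibriumModel Γ M)
proposition12 _ Γ M total = equilibrium⇒safe-belief total , safe-belief⇒equilibrium total
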